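{- Let $A$ be an alphabet and let $(X,\langle o,\delta\rangle)$ be an alternating automaton, with $o:X\to\mathbf{2}$ and $\delta:X\to\mathrm{Alt}(X)^A$. Let $b:X\to\mathbf{2}^{A^*}$ be a map. Then the following are equivalent: (i) $\langle O,D\rangle\circ b=(\mathrm{id}_{\mathbf{2}}\times\hat\beta^A)\circ(\mathrm{id}_{\mathbf{2}}\times\mathrm{Alt}(b)^A)\circ\langle o,\delta\rangle$. Here $\hat\beta^A$ and $\mathrm{Alt}(b)^A$ denote post-composition. (ii) For every $q\in X$, $b(q)(\varepsilon)=o(q)$. Moreover, for every $q\in X$, $a\in A$, $w\in A^*$: $b(q)(a\cdot w)=\mathbf{1}$ if and only if there exists $F\in\delta(q)(a)$ such that $b(q')(w)=\mathbf{1}$ for all $q'\in F$. Furthermore, there exists a unique map $b$ satisfying these conditions.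
   Context: $\mathbf{2}=\{\mathbf{0},\mathbf{1}\}$. $A^*$ is the set of finite words over $A$ and $\varepsilon$ is the empty word. $\mathbf{2}^{A^*}$ is the set of languages, viewed as functions $A^*\to\mathbf{2}$. The functor $\mathrm{Alt}$ and the algebra $\beta$: - For a set $Y$, $\mathrm{Alt}(Y)$ is the set of families of subsets of $Y$ that are upward closed under inclusion. - For $f:Y\to Z$, $\mathrm{Alt}(f)(S)=\{T\subseteq Z\mid\exists s\in S,\ f(s)\subseteq T\}$, where $f(s)$ is the direct image. - $\beta:\mathrm{Alt}(\mathbf{2})\to\mathbf{2}$ is given by $\beta(S)=\mathbf{1}$ iff $\{\mathbf{1}\}\in S$. - $\hat\beta:\mathrm{Alt}(\mathbf{2}^{A^*})\to\mathbf{2}^{A^*}$ is the pointwise algebra $\hat\beta(S)(w)=\beta(\mathrm{Alt}(\mathrm{ev}_w)(S))$, where $\mathrm{ev}_w(L)=L(w)$. The final deterministic automaton structure is $\langle O,D\rangle:\mathbf{2}^{A^*}\to\mathbf{2}\times(\mathbf{2}^{A^*})^A$, with $O(L)=L(\varepsilon)$ and $D(L)(a)(w)=L(a\cdot w)$. An alternating automaton over $A$ is a set $X$ of states with $o:X\to\mathbf{2}$ (accepting states) and $\delta:X\to\mathrm{Alt}(X)^A$; the elements of $\delta(q)(a)$ are called forks. -}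

module Defs where

open import Level using (0ℓ) renaming (suc to lsuc)
open import Data.Bool using (Bool; true; false)
open import Data.List using (List; []; _∷_)
open import Data.Product using (Σ; _×_; _,_; proj₁; proj₂)
open import Relation.Unary using (Pred; _⊆_)
open import Relation.Nullary using (Dec; yes; no)
open import Relation.Nullary.Decidable using (isYes)
open import Relation.Binary.PropositionalEquality using (_≡_)
open import Axiom.ExcludedMiddle using (ExcludedMiddle)
open import Function.Bundles using (_⇔_)

-- 2 = Bool (false = 𝟎, true = 𝟏).  Subsets of Y are predicates Pred Y 0ℓ.

record Alt (Y : Set) : Set₂ where
  field
    fam    : Pred (Pred Y 0ℓ) (lsuc 0ℓ)
    upward : ∀ {s t : Pred Y 0ℓ} → fam s → s ⊆ t → fam t
open Alt public

ImageSub : {Y Z : Set} → (Y → Z) → Pred Y 0ℓ → Pred Z 0ℓ → Set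
ImageSub f s T = ∀ y → s y → T (f y)

Alt-map : {Y Z : Set} → (Y → Z) → Alt Y → Alt Z
Alt-map f S = record
  { fam    = λ T → Σ (Pred _ 0ℓ) (λ s → fam S s × ImageSub f s T)
  ; upward = λ { (s , sS , im) t⊆ → s , sS , (λ y sy → t⊆ (im y sy)) }
  }

one : Pred Bool 0ℓ
one x = x ≡ true

β : ExcludedMiddle (lsuc 0ℓ) → Alt Bool → Bool
β em S = isYes (em {fam S one})

Lang : Set → Set
Lang A = List A → Bool

ev : {A : Set} → List A → Lang A → Bool
ev w L = L w

βhat : ExcludedMiddle (lsuc 0ℓ) → {A : Set} → Alt (Lang A) → Lang A
βhat em S w = β em (Alt-map (ev w) S)

O : {A : Set} → Lang A → Bool
O L = L []

D : {A : Set} → Lang A → A → Lang A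
D L a w = L (a ∷ w)

-- condition (i), equalities of languages read pointwise (extensionally)
CondI : ExcludedMiddle (lsuc 0ℓ) → {A X : Set} → (X → Bool) → (X → A → Alt X)
      → (X → Lang A) → Set
CondI em {A} {X} o δ b =
  (∀ (q : X) → O (b q) ≡ o q) ×
  (∀ (q : X) (a : A) (w : List A) → D (b q) a w ≡ βhat em (Alt-map b (δ q a)) w)

CondII : {A X : Set} → (X → Bool) → (X → A → Alt X) → (X → Lang A) → Set₁
CondII {A} {X} o δ b =
  (∀ (q : X) → b q [] ≡ o q) ×
  (∀ (q : X) (a : A) (w : List A) →
     (b q (a ∷ w) ≡ true) ⇔
     Σ (Pred X 0ℓ) (λ F → fam (δ q a) F × (∀ q' → F q' → b q' w ≡ true)))

module Submission where

open import Defs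
open import Level using (0ℓ) renaming (suc to lsuc)
open import Data.Bool using (Bool; true)
open import Data.Bool.Properties using (T-≡; ⇔→≡)
open import Data.List using (List; []; _∷_)
open import Data.Product using (Σ; _×_; _,_)
open import Function using (_∘_)
open import Function.Bundles using (_⇔_; mk⇔; Equivalence)
open import Function.Construct.Composition using (_⇔-∘_)
open import Function.Construct.Identity using (⇔-id)
open import Function.Construct.Symmetry using (⇔-sym)
open import Relation.Unary using (Pred)
open import Relation.Nullary using (Dec)
open import Relation.Nullary.Decidable using (isYes; toWitness; fromWitness)
open import Relation.Binary.PropositionalEquality using (_≡_; refl)
open import Axiom.ExcludedMiddle using (ExcludedMiddle)

-- Since β̂ only inspects whether {𝟏} lies in the image family, β̂ (Alt(b)(δ q a)) accepts w
-- exactly when some fork of δ q a consists of states whose languages contain w; this turns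
-- (i) into (ii). Condition (ii) determines b q w by recursion on w, which gives both the
-- existence (define b by that recursion) and the uniqueness (induction on w).

isYes≡true⇔ : ∀ {ℓ} {P : Set ℓ} (P? : Dec P) → isYes P? ≡ true ⇔ P
isYes≡true⇔ P? = mk⇔ toWitness fromWitness ⇔-∘ ⇔-sym T-≡

≡true-cong : {x y : Bool} → x ≡ y → (x ≡ true ⇔ y ≡ true)
≡true-cong refl = ⇔-id _

Alt-map-∘ : {Y Z W : Set} (f : Y → Z) (g : Z → W) (S : Alt Y) (T : Pred W 0ℓ) →
            fam (Alt-map g (Alt-map f S)) T ⇔ fam (Alt-map (g ∘ f) S) T
Alt-map-∘ f g S T = mk⇔
  (λ { (_ , (r , r∈S , f[r]⊆s) , g[s]⊆T) → r , r∈S , λ y r∋y → g[s]⊆T (f y) (f[r]⊆s y r∋y) })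
  (λ { (r , r∈S , gf[r]⊆T) → (λ z → T (g z)) , (r , r∈S , gf[r]⊆T) , (λ _ T∋gz → T∋gz) })

β≡true⇔ : (em : ExcludedMiddle (lsuc 0ℓ)) (S : Alt Bool) → β em S ≡ true ⇔ fam S one
β≡true⇔ em S = isYes≡true⇔ em

SomeForkAccepts : {X : Set} → (X → Bool) → Alt X → Set₁
SomeForkAccepts {X} v S = Σ (Pred X 0ℓ) (λ F → fam S F × (∀ q → F q → v q ≡ true))

SomeForkAccepts-mono : {X : Set} {v v' : X → Bool} {S : Alt X} →
                       (∀ q → v q ≡ true → v' q ≡ true) →
                       SomeForkAccepts v S → SomeForkAccepts v' S
SomeForkAccepts-mono v⊆v' (F , F∈S , F⊆v) = F , F∈S , λ q F∋q → v⊆v' q (F⊆v q F∋q)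

SomeForkAccepts-cong : {X : Set} {v v' : X → Bool} {S : Alt X} →
                       (∀ q → v q ≡ v' q) → SomeForkAccepts v S ⇔ SomeForkAccepts v' S
SomeForkAccepts-cong {S = S} v≗v' = mk⇔
  (SomeForkAccepts-mono {S = S} (λ q → Equivalence.to (≡true-cong (v≗v' q))))
  (SomeForkAccepts-mono {S = S} (λ q → Equivalence.from (≡true-cong (v≗v' q))))

module _ (em : ExcludedMiddle (lsuc 0ℓ)) {A X : Set} where

  -- SomeForkAccepts v S is definitionally fam (Alt-map v S) one.
  βhat-Alt-map≡true⇔ : (b : X → Lang A) (S : Alt X) (w : List A) →
                       βhat em (Alt-map b S) w ≡ true ⇔ SomeForkAccepts (λ q → b q w) S
  βhat-Alt-map≡true⇔ b S w = Alt-map-∘ b (ev w) S one ⇔-∘ β≡true⇔ em (Alt-map (ev w) (Alt-map b S))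

  module _ (o : X → Bool) (δ : X → A → Alt X) where

    CondI⇔CondII : (b : X → Lang A) → CondI em o δ b ⇔ CondII o δ b
    CondI⇔CondII b = mk⇔
      (λ { (b[]≡o , Db≡βhat) → b[]≡o , λ q a w →
             βhat-Alt-map≡true⇔ b (δ q a) w ⇔-∘ ≡true-cong (Db≡βhat q a w) })
      (λ { (b[]≡o , b[a∷w]⇔fork) → b[]≡o , λ q a w →
             ⇔→≡ (⇔-sym (βhat-Alt-map≡true⇔ b (δ q a) w) ⇔-∘ b[a∷w]⇔fork q a w) })

    accepts : X → Lang A
    accepts q []      = o q
    accepts q (a ∷ w) = isYes (em {SomeForkAccepts (λ q' → accepts q' w) (δ q a)})

    accepts-CondII : CondII o δ accepts
    accepts-CondII = (λ _ → refl) , λ q a w → isYes≡true⇔ em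

    CondII-unique : {b : X → Lang A} → CondII o δ b → ∀ q w → b q w ≡ accepts q w
    CondII-unique (b[]≡o , _) q [] = b[]≡o q
    CondII-unique c@(_ , b[a∷w]⇔fork) q (a ∷ w) = ⇔→≡
      (⇔-sym (isYes≡true⇔ em)
        ⇔-∘ (SomeForkAccepts-cong {S = δ q a} (λ q' → CondII-unique c q' w) ⇔-∘ b[a∷w]⇔fork q a w))

mainTheorem8 : (em : ExcludedMiddle (lsuc 0ℓ)) {A X : Set} (o : X → Bool) (δ : X → A → Alt X) →
    ((b : X → Lang A) → CondI em o δ b ⇔ CondII o δ b) ×
    Σ (X → Lang A) (λ b → CondI em o δ b ×
      ((b' : X → Lang A) → CondI em o δ b' → (q : X) (w : List A) → b' q w ≡ b q w))
mainTheorem8 em o δ =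
    CondI⇔CondII em o δ
  , accepts em o δ
  , Equivalence.from (CondI⇔CondII em o δ (accepts em o δ)) (accepts-CondII em o δ)
  , λ b' b'-CondI → CondII-unique em o δ (Equivalence.to (CondI⇔CondII em o δ b') b'-CondI)
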